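{- Let $p$ be a prime and let $A,A'$ be $n\times m$ matrices over $\mathbb{Z}_p$ that differ in exactly one entry: $a'_{ij}\neq a_{ij}$ for one position $(i,j)$, and all other entries are equal. If $B$ is an $A$-good basis of $\mathbb{Z}_p^m$ and $B'$ is constructed from $B$ by the procedure described below, then $B'$ is an $A'$-good basis of $\mathbb{Z}_p^m$.
   Context: Definitions (for a matrix $M\in\mathbb{Z}_p^{n\times m}$): the kernel is $\{v: Mv=0\}$; $S_M(v)=\{k\in[n]:(Mv)_k\neq0\}$. For a basis $B$ of $\mathbb{Z}_p^m$, $v\in B$ is $k$-unique w.r.t. $B$ and $M$ if $k\in S_M(v)$ and $k\notin S_M(w)$ for all other $w\in B$. $B$ is $M$-good if every $v\in B$ not in the kernel of $M$ is $k$-unique for some $k$; for such $v$ the least such $k$ is its principal component $\mathrm{pc}(v)$. Write $K$ for the kernel of $A$, $S(v)=S_A(v)$, $S'(v)=S_{A'}(v)$. Procedure. Let $u$ be the unique vector of $B$ with $\mathrm{pc}(u)=i$, if one exists. Let $U=\{u\}$ if $u$ exists and $i\in S'(u)$, else $U=\emptyset$; $V=\{v\in B\cap K: i\in S'(v)\}$; $W=\{w\in B\setminus K: i\in S'(w), w\neq u\}$. Fix a linear order on vectors. (0) Start with $B':=B$. (1) If $U\cup V\neq\emptyset$: (a) if $V\neq\emptyset$ let $\hat v$ be the minimal element of $V$; otherwise let $\hat v:=u$. (b) In $B'$: (i) replace each $w\in W$ by $w-(A'w)_i(A'\hat v)_i^{ -1}\hat v$; (ii) if $\hat v\in V$, replace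 each $v\in V$, $v\neq\hat v$, by $v-(A'v)_i(A'\hat v)_i^{ -1}\hat v$; (iii) if $\hat v\in V$ and $U\neq\emptyset$, replace $u$ by $\hat u:=u-(A'u)_i(A'\hat v)_i^{ -1}\hat v$. (c) If $u$ exists and $i\notin S'(u)$, let $\hat u:=u$. (Also, if $U\cup V=\emptyset$ and $u$ exists, then $i\notin S'(u)$ and $\hat u:=u$.) (2) If $\hat u$ has been defined and $S'(\hat u)\neq\emptyset$: let $k$ be the minimal element of $S'(\hat u)$, and replace every vector $v\in B'$, $v\neq\hat u$, with $k\in S'(v)$ by $v-(A'v)_k(A'\hat u)_k^{ -1}\hat u$. The resulting set is $B'$. -}

module Defs where

open import Level using (0ℓ)
open import Data.Nat as ℕ using (ℕ; zero; suc; NonZero; _∸_)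
open import Data.Nat.DivMod using (_mod_)
open import Data.Fin as F using (Fin; toℕ)
open import Data.Fin.Properties using () renaming (_≟_ to _≟ᶠ_)
open import Data.Vec as Vec using (Vec; []; _∷_; lookup; zipWith; replicate; tabulate)
open import Data.Bool using (Bool; true; false; not; _∧_; _∨_; if_then_else_)
open import Data.Maybe using (Maybe; just; nothing)
open import Data.Product using (Σ; ∃; _×_; _,_)
open import Data.Empty using (⊥)
open import Relation.Nullary using (¬_; does)
open import Relation.Binary using (Rel; Tri; tri<; tri≈; tri>)
open import Relation.Binary.Structures using (IsStrictTotalOrder)
open import Relation.Binary.PropositionalEquality using (_≡_; _≢_)
open import Function using (_∘_)

first : ∀ {n} → (Fin n → Bool) → Maybe (Fin n)
first {zero} f = nothing
first {suc n} f = if f F.zero then just F.zero else Data.Maybe.map F.suc (first (f ∘ F.suc))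
  where import Data.Maybe

isJust : ∀ {A : Set} → Maybe A → Bool
isJust (just _) = true
isJust nothing = false

eqFin : ∀ {n} → Fin n → Fin n → Bool
eqFin a b = does (a ≟ᶠ b)

module Zp (p : ℕ) {{_ : NonZero p}} where

  𝔽 : Set
  𝔽 = Fin p

  0# : 𝔽
  0# = 0 mod p

  _+_ : 𝔽 → 𝔽 → 𝔽
  a + b = (toℕ a ℕ.+ toℕ b) mod p

  _*_ : 𝔽 → 𝔽 → 𝔽
  a * b = (toℕ a ℕ.* toℕ b) mod p

  -_ : 𝔽 → 𝔽
  - a = (p ∸ toℕ a) mod p

  _-_ : 𝔽 → 𝔽 → 𝔽
  a - b = a + (- b)

  -- multiplicative inverse in ℤ_p for p prime (Fermat: a⁻¹ = a^(p-2))
  _⁻¹ : 𝔽 → 𝔽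
  a ⁻¹ = (toℕ a ℕ.^ (p ∸ 2)) mod p

  isZero : 𝔽 → Bool
  isZero a = does (a ≟ᶠ 0#)

  Vect : ℕ → Set
  Vect m = Vec 𝔽 m

  Mat : ℕ → ℕ → Set
  Mat n m = Vec (Vec 𝔽 m) n

  entry : ∀ {n m} → Mat n m → Fin n → Fin m → 𝔽
  entry M k l = lookup (lookup M k) l

  0ᵥ : ∀ {m} → Vect m
  0ᵥ = replicate _ 0#

  _+ᵥ_ : ∀ {m} → Vect m → Vect m → Vect m
  _+ᵥ_ = zipWith _+_

  _-ᵥ_ : ∀ {m} → Vect m → Vect m → Vect m
  _-ᵥ_ = zipWith _-_

  _•_ : ∀ {m} → 𝔽 → Vect m → Vect m
  c • v = Vec.map (c *_) v

  _·_ : ∀ {m} → Vect m → Vect m → 𝔽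
  u · v = Vec.foldr _ _+_ 0# (zipWith _*_ u v)

  _*ᵥ_ : ∀ {n m} → Mat n m → Vect m → Vect n
  M *ᵥ v = Vec.map (_· v) M

  _⟨_⟩_ : ∀ {n m} → Mat n m → Vect m → Fin n → 𝔽
  M ⟨ v ⟩ k = lookup (M *ᵥ v) k

  InKernel : ∀ {n m} → Mat n m → Vect m → Set
  InKernel M v = M *ᵥ v ≡ 0ᵥ

  _∈S[_]_ : ∀ {n m} → Fin n → Mat n m → Vect m → Set
  k ∈S[ M ] v = M ⟨ v ⟩ k ≢ 0#

  inKᵇ : ∀ {n m} → Mat n m → Vect m → Bool
  inKᵇ {n} M v = not (isJust (first {n} (λ k → not (isZero (M ⟨ v ⟩ k)))))

  Sᵇ : ∀ {n m} → Mat n m → Vect m → Fin n → Bool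
  Sᵇ M v k = not (isZero (M ⟨ v ⟩ k))

  Family : ℕ → ℕ → Set
  Family r m = Fin r → Vect m

  lincomb : ∀ {r m} → (Fin r → 𝔽) → Family r m → Vect m
  lincomb c B = Vec.foldr _ _+ᵥ_ 0ᵥ (tabulate (λ j → c j • B j))

  LinIndep : ∀ {r m} → Family r m → Set
  LinIndep B = ∀ c → lincomb c B ≡ 0ᵥ → ∀ j → c j ≡ 0#

  Spans : ∀ {r m} → Family r m → Set
  Spans {m = m} B = ∀ (v : Vect m) → ∃ λ c → lincomb c B ≡ v

  IsBasis : ∀ {r m} → Family r m → Set
  IsBasis B = LinIndep B × Spans B

  Unique : ∀ {r n m} → Mat n m → Family r m → Fin r → Fin n → Set
  Unique M B j k = (k ∈S[ M ] B j) × (∀ j' → j' ≢ j → ¬ (k ∈S[ M ] B j'))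

  Good : ∀ {r n m} → Mat n m → Family r m → Set
  Good M B = ∀ j → ¬ InKernel M (B j) → ∃ λ k → Unique M B j k

  uniqueᵇ : ∀ {r n m} → Mat n m → Family r m → Fin r → Fin n → Bool
  uniqueᵇ {r} M B j k =
    Sᵇ M (B j) k ∧ not (isJust (first {r} (λ j' → not (eqFin j' j) ∧ Sᵇ M (B j') k)))

  pc : ∀ {r n m} → Mat n m → Family r m → Fin r → Maybe (Fin n)
  pc {n = n} M B j = first {n} (uniqueᵇ M B j)

  module Procedure {r n m : ℕ} (A A' : Mat n m) (i : Fin n)
                   {_≺_ : Rel (Vect m) 0ℓ} (ord : IsStrictTotalOrder _≡_ _≺_)
                   (B : Family r m) where

    pcIsI : Fin r → Bool
    pcIsI j with pc A B j
    ... | just k = eqFin k i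
    ... | nothing = false

    u? : Maybe (Fin r)
    u? = first pcIsI

    S'ᵇ : Vect m → Fin n → Bool
    S'ᵇ = Sᵇ A'

    Uᵇ : Bool
    Uᵇ with u?
    ... | just ju = S'ᵇ (B ju) i
    ... | nothing = false

    isU : Fin r → Bool
    isU j with u?
    ... | just ju = eqFin j ju
    ... | nothing = false

    inV : Fin r → Bool
    inV j = inKᵇ A (B j) ∧ S'ᵇ (B j) i

    inW : Fin r → Bool
    inW j = not (inKᵇ A (B j)) ∧ S'ᵇ (B j) i ∧ not (isU j)

    minBy : ∀ {s} → (Fin s → Fin r) → (Fin r → Bool) → Maybe (Fin r)
    minBy {zero} g P = nothing
    minBy {suc s} g P with minBy (g ∘ F.suc) P | P (g F.zero)
    ... | rest | false = rest
    ... | nothing | true = just (g F.zero)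
    ... | just j | true with IsStrictTotalOrder.compare ord (B (g F.zero)) (B j)
    ...   | tri< _ _ _ = just (g F.zero)
    ...   | tri≈ _ _ _ = just (g F.zero)
    ...   | tri> _ _ _ = just j

    vmin? : Maybe (Fin r)
    vmin? = minBy (λ j → j) inV

    Vᵇ : Bool
    Vᵇ = isJust vmin?

    vhat? : Maybe (Fin r)
    vhat? with vmin?
    ... | just jv = just jv
    ... | nothing = if Uᵇ then u? else nothing

    reduce : Fin n → Vect m → Vect m → Vect m
    reduce k h w = w -ᵥ (((A' ⟨ w ⟩ k) * ((A' ⟨ h ⟩ k) ⁻¹)) • h)

    step1 : Family r m
    step1 j with vhat?
    ... | nothing = B j
    ... | just h =
      if inW j ∨ (Vᵇ ∧ inV j ∧ not (eqFin j h)) ∨ (Vᵇ ∧ Uᵇ ∧ isU j)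
      then reduce i (B h) (B j) else B j

    -- index of û (if û is defined); û itself is step1 at this index
    uhat? : Maybe (Fin r)
    uhat? with u?
    ... | nothing = nothing
    ... | just ju = if S'ᵇ (B ju) i then (if Vᵇ then just ju else nothing) else just ju

    result : Family r m
    result with uhat?
    ... | nothing = step1
    ... | just ju with first (S'ᵇ (step1 ju))
    ...   | nothing = step1
    ...   | just k = λ j →
            if not (eqFin j ju) ∧ S'ᵇ (step1 j) k
            then reduce k (step1 ju) (step1 j) else step1 j

module Submission where

-- Proposition 2: let A' differ from A in one entry (only the fact that they
-- agree off row i is used).  If B is an A-good basis of ℤ_p^m, the
-- procedure of Defs turns B into an A'-good basis B'.

open import Defs
open import Level using (0ℓ)
open import Data.Nat as ℕ using (ℕ; zero; suc; NonZero; _∸_)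
open import Data.Nat.Properties as ℕP using ()
open import Data.Nat.DivMod using (_mod_; _%_; %-distribˡ-+; %-distribˡ-*; m<n⇒m%n≡m; n%n≡0; m*n%n≡0; %-remove-+ʳ)
open import Data.Nat.Divisibility using (_∣_; m%n≡0⇒n∣m; ∣⇒≤; n∣m*n)
open import Data.Nat.Primality using (Prime; prime⇒nonTrivial; euclidsLemma)
open import Data.Nat.Coprimality using (prime⇒coprime; coprime-Bézout)
open import Data.Nat.GCD using (module Bézout)
open import Data.Fin as F using (Fin; toℕ)
open import Data.Fin.Properties as FinP using (toℕ-injective; toℕ<n; toℕ-fromℕ<)
open import Data.Sum using (_⊎_; inj₁; inj₂)
open import Data.Product using (Σ; _×_; _,_; proj₁; proj₂)
open import Data.Empty using (⊥-elim)
open import Relation.Nullary using (¬_)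
open import Relation.Binary using (Rel)
open import Relation.Binary.Structures using (IsStrictTotalOrder)
open import Relation.Binary.PropositionalEquality
  using (_≡_; _≢_; refl; sym; trans; cong; cong₂; subst; isEquivalence; module ≡-Reasoning)
open import Algebra.Bundles using (CommutativeRing)
open import Algebra.Structures using (IsCommutativeRing)

-- ℤ_p is a commutative ring for every modulus p > 1.  Every law is
-- transported from ℕ along the reduction map [_] : ℕ → ℤ_p, which is
-- surjective ([toℕ]) and a homomorphism for + and * (+-hom, *-hom).
module ZpRing (p : ℕ) {{_ : NonZero p}} (1<p : 1 ℕ.< p) where

  open Zp p

  1# : 𝔽
  1# = 1 mod p

  [_] : ℕ → 𝔽
  [ x ] = x mod p

  toℕ-[] : ∀ x → toℕ [ x ] ≡ x % p
  toℕ-[] x = toℕ-fromℕ< _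

  []-cong : ∀ {x y} → x % p ≡ y % p → [ x ] ≡ [ y ]
  []-cong {x} {y} e = toℕ-injective (trans (toℕ-[] x) (trans e (sym (toℕ-[] y))))

  [toℕ] : ∀ (a : 𝔽) → [ toℕ a ] ≡ a
  [toℕ] a = toℕ-injective (trans (toℕ-[] (toℕ a)) (m<n⇒m%n≡m (toℕ<n a)))

  +-hom : ∀ x y → [ x ] + [ y ] ≡ [ x ℕ.+ y ]
  +-hom x y = []-cong (trans (cong₂ (λ a b → (a ℕ.+ b) % p) (toℕ-[] x) (toℕ-[] y)) (sym (%-distribˡ-+ x y p)))

  *-hom : ∀ x y → [ x ] * [ y ] ≡ [ x ℕ.* y ]
  *-hom x y = []-cong (trans (cong₂ (λ a b → (a ℕ.* b) % p) (toℕ-[] x) (toℕ-[] y)) (sym (%-distribˡ-* x y p)))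

  toℕ-0# : toℕ 0# ≡ 0
  toℕ-0# = trans (toℕ-[] 0) (m<n⇒m%n≡m (ℕP.<-trans ℕ.z<s 1<p))

  toℕ-1# : toℕ 1# ≡ 1
  toℕ-1# = trans (toℕ-[] 1) (m<n⇒m%n≡m 1<p)

  +-assoc : ∀ a b c → (a + b) + c ≡ a + (b + c)
  +-assoc a b c = begin
    [ toℕ a ℕ.+ toℕ b ] + c             ≡⟨ cong ([ toℕ a ℕ.+ toℕ b ] +_) (sym ([toℕ] c)) ⟩
    [ toℕ a ℕ.+ toℕ b ] + [ toℕ c ]     ≡⟨ +-hom _ _ ⟩
    [ toℕ a ℕ.+ toℕ b ℕ.+ toℕ c ]       ≡⟨ cong [_] (ℕP.+-assoc (toℕ a) _ _) ⟩
    [ toℕ a ℕ.+ (toℕ b ℕ.+ toℕ c) ]     ≡⟨ sym (+-hom _ _) ⟩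
    [ toℕ a ] + (b + c)                 ≡⟨ cong (_+ (b + c)) ([toℕ] a) ⟩
    a + (b + c)                         ∎
    where open ≡-Reasoning

  *-assoc : ∀ a b c → (a * b) * c ≡ a * (b * c)
  *-assoc a b c = begin
    [ toℕ a ℕ.* toℕ b ] * c             ≡⟨ cong ([ toℕ a ℕ.* toℕ b ] *_) (sym ([toℕ] c)) ⟩
    [ toℕ a ℕ.* toℕ b ] * [ toℕ c ]     ≡⟨ *-hom _ _ ⟩
    [ toℕ a ℕ.* toℕ b ℕ.* toℕ c ]       ≡⟨ cong [_] (ℕP.*-assoc (toℕ a) _ _) ⟩
    [ toℕ a ℕ.* (toℕ b ℕ.* toℕ c) ]     ≡⟨ sym (*-hom _ _) ⟩
    [ toℕ a ] * (b * c)                 ≡⟨ cong (_* (b * c)) ([toℕ] a) ⟩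
    a * (b * c)                         ∎
    where open ≡-Reasoning

  +-comm : ∀ a b → a + b ≡ b + a
  +-comm a b = cong [_] (ℕP.+-comm (toℕ a) (toℕ b))

  *-comm : ∀ a b → a * b ≡ b * a
  *-comm a b = cong [_] (ℕP.*-comm (toℕ a) (toℕ b))

  +-identityˡ : ∀ a → 0# + a ≡ a
  +-identityˡ a = trans (cong (λ z → [ z ℕ.+ toℕ a ]) toℕ-0#) ([toℕ] a)

  *-identityˡ : ∀ a → 1# * a ≡ a
  *-identityˡ a = trans (cong (λ z → [ z ℕ.* toℕ a ]) toℕ-1#) (trans (cong [_] (ℕP.+-identityʳ (toℕ a))) ([toℕ] a))

  0%p : 0 % p ≡ 0
  0%p = m<n⇒m%n≡m (ℕP.<-trans ℕ.z<s 1<p)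

  -‿inverseʳ : ∀ a → a + (- a) ≡ 0#
  -‿inverseʳ a = begin
    a + (- a)                   ≡⟨ cong (_+ (- a)) (sym ([toℕ] a)) ⟩
    [ toℕ a ] + [ p ∸ toℕ a ]   ≡⟨ +-hom _ _ ⟩
    [ toℕ a ℕ.+ (p ∸ toℕ a) ]   ≡⟨ cong [_] (ℕP.m+[n∸m]≡n (ℕP.<⇒≤ (toℕ<n a))) ⟩
    [ p ]                       ≡⟨ []-cong (trans (n%n≡0 p) (sym 0%p)) ⟩
    0#                          ∎
    where open ≡-Reasoning

  *-distribˡ-+ : ∀ a b c → a * (b + c) ≡ (a * b) + (a * c)
  *-distribˡ-+ a b c = begin
    a * (b + c)                                   ≡⟨ cong (_* (b + c)) (sym ([toℕ] a)) ⟩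
    [ toℕ a ] * [ toℕ b ℕ.+ toℕ c ]               ≡⟨ *-hom _ _ ⟩
    [ toℕ a ℕ.* (toℕ b ℕ.+ toℕ c) ]               ≡⟨ cong [_] (ℕP.*-distribˡ-+ (toℕ a) (toℕ b) (toℕ c)) ⟩
    [ toℕ a ℕ.* toℕ b ℕ.+ toℕ a ℕ.* toℕ c ]       ≡⟨ sym (+-hom _ _) ⟩
    [ toℕ a ℕ.* toℕ b ] + [ toℕ a ℕ.* toℕ c ]     ∎
    where open ≡-Reasoning

  isCommutativeRing : IsCommutativeRing _≡_ _+_ _*_ (λ a → - a) 0# 1#
  isCommutativeRing = record
    { isRing = record
      { +-isAbelianGroup = record
        { isGroup = record
          { isMonoid = record
            { isSemigroup = record
              { isMagma = record { isEquivalence = isEquivalence ; ∙-cong = cong₂ _+_ }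
              ; assoc = +-assoc }
            ; identity = +-identityˡ , λ a → trans (+-comm a 0#) (+-identityˡ a) }
          ; inverse = (λ a → trans (+-comm (- a) a) (-‿inverseʳ a)) , -‿inverseʳ
          ; ⁻¹-cong = cong (λ a → - a) }
        ; comm = +-comm }
      ; *-cong = cong₂ _*_
      ; *-assoc = *-assoc
      ; *-identity = *-identityˡ , λ a → trans (*-comm a 1#) (*-identityˡ a)
      ; distrib = *-distribˡ-+ , λ a b c → trans (*-comm (b + c) a)
                    (trans (*-distribˡ-+ a b c) (cong₂ _+_ (*-comm a b) (*-comm a c))) }
    ; *-comm = *-comm }

  commutativeRing : CommutativeRing 0ℓ 0ℓ
  commutativeRing = record { isCommutativeRing = isCommutativeRing }

-- ℤ_p is a field for p prime: it has no zero divisors (Euclid's lemma),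
-- every nonzero element has an inverse (Bézout), and, by Fermat's little
-- theorem a^(p-1) = 1, the inverse used in Defs, a ⁻¹ = a^(p-2), is that
-- inverse.  Fermat is proved by comparing the product of all nonzero
-- elements with the product of their multiples by a.
module ZpField (q : ℕ) (p-prime : Prime (suc q)) where

  open import Algebra.Properties.CommutativeMonoid.Sum as MonoidSum using ()
  open import Data.Fin.Permutation using (Permutation; permutation)
  import Algebra.Properties.Group as GroupProperties
  import Algebra.Properties.Ring as RingProperties

  private
    p : ℕ
    p = suc q

  1<p : 1 ℕ.< p
  1<p = ℕ.nonTrivial⇒n>1 p {{prime⇒nonTrivial p-prime}}

  open Zp p
  open ZpRing p 1<p public
  open CommutativeRing commutativeRing using (*-commutativeMonoid; +-group; ring; *-identityʳ; zeroʳ)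

  p∣⇒≡0# : ∀ (a : 𝔽) → p ∣ toℕ a → a ≡ 0#
  p∣⇒≡0# a d with toℕ a in eq
  ... | zero  = toℕ-injective (trans eq (sym toℕ-0#))
  ... | suc _ = ⊥-elim (ℕP.<⇒≱ (subst (ℕ._< p) eq (toℕ<n a)) (∣⇒≤ d))

  *-noZeroDivisors : ∀ {a b : 𝔽} → a ≢ 0# → b ≢ 0# → (a * b) ≢ 0#
  *-noZeroDivisors {a} {b} a≢0 b≢0 ab≡0
    with euclidsLemma (toℕ a) (toℕ b) p-prime
           (m%n≡0⇒n∣m (toℕ a ℕ.* toℕ b) p (trans (sym (toℕ-[] (toℕ a ℕ.* toℕ b))) (trans (cong toℕ ab≡0) toℕ-0#)))
  ... | inj₁ p∣a = a≢0 (p∣⇒≡0# a p∣a)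
  ... | inj₂ p∣b = b≢0 (p∣⇒≡0# b p∣b)

  1#≢0# : 1# ≢ 0#
  1#≢0# e = ℕP.1+n≢0 (trans (sym toℕ-1#) (trans (cong toℕ e) toℕ-0#))

  private
    module G = GroupProperties +-group
    module R = RingProperties ring
    module Π = MonoidSum *-commutativeMonoid

  -- every nonzero residue is invertible: Bézout for the coprime pair (p, a)
  inverse-exists : ∀ (a : 𝔽) → a ≢ 0# → Σ 𝔽 (λ b → (a * b) ≡ 1#)
  inverse-exists a a≢0
    with coprime-Bézout (prime⇒coprime p-prime {{ℕ.≢-nonZero toℕa≢0}} (toℕ<n a))
    where
    toℕa≢0 : toℕ a ≢ 0
    toℕa≢0 e = a≢0 (toℕ-injective (trans e (sym toℕ-0#)))
  ... | Bézout.-+ x y e = [ y ] , (begin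
    a * [ y ]                  ≡⟨ cong (_* [ y ]) (sym ([toℕ] a)) ⟩
    [ toℕ a ] * [ y ]          ≡⟨ *-hom (toℕ a) y ⟩
    [ toℕ a ℕ.* y ]            ≡⟨ cong [_] (trans (ℕP.*-comm (toℕ a) y) (sym e)) ⟩
    [ 1 ℕ.+ x ℕ.* p ]          ≡⟨ []-cong {1 ℕ.+ x ℕ.* p} {1} (%-remove-+ʳ 1 {x ℕ.* p} {p} (n∣m*n x)) ⟩
    1#                         ∎)
    where open ≡-Reasoning
  ... | Bézout.+- x y e = - [ y ] , (begin
    a * (- [ y ])              ≡⟨ sym (R.-‿distribʳ-* a [ y ]) ⟩
    - (a * [ y ])              ≡⟨ sym (G.inverseˡ-unique 1# _ 1+ay≡0) ⟩
    1#                         ∎)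
    where
    open ≡-Reasoning
    1+ay≡0 : 1# + (a * [ y ]) ≡ 0#
    1+ay≡0 = begin
      1# + (a * [ y ])           ≡⟨ cong (λ t → 1# + (t * [ y ])) (sym ([toℕ] a)) ⟩
      1# + ([ toℕ a ] * [ y ])   ≡⟨ cong (1# +_) (*-hom (toℕ a) y) ⟩
      [ 1 ] + [ toℕ a ℕ.* y ]    ≡⟨ +-hom 1 (toℕ a ℕ.* y) ⟩
      [ 1 ℕ.+ toℕ a ℕ.* y ]      ≡⟨ cong (λ t → [ 1 ℕ.+ t ]) (ℕP.*-comm (toℕ a) y) ⟩
      [ 1 ℕ.+ y ℕ.* toℕ a ]      ≡⟨ cong [_] e ⟩
      [ x ℕ.* p ]                ≡⟨ []-cong {x ℕ.* p} {0} (trans (m*n%n≡0 x p) (sym 0%p)) ⟩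
      0#                         ∎

  _^_ : 𝔽 → ℕ → 𝔽
  a ^ zero  = 1#
  a ^ suc k = a * (a ^ k)

  product-const : ∀ k a → Π.sum {k} (λ _ → a) ≡ a ^ k
  product-const zero    a = refl
  product-const (suc k) a = cong (a *_) (product-const k a)

  ^-hom : ∀ x k → [ x ℕ.^ k ] ≡ [ x ] ^ k
  ^-hom x zero    = refl
  ^-hom x (suc k) = trans (sym (*-hom x (x ℕ.^ k))) (cong ([ x ] *_) (^-hom x k))

  product-nonzero : ∀ {k} (f : Fin k → 𝔽) → (∀ x → f x ≢ 0#) → Π.sum f ≢ 0#
  product-nonzero {zero}  f f≢0 = 1#≢0#
  product-nonzero {suc k} f f≢0 =
    *-noZeroDivisors (f≢0 F.zero) (product-nonzero (λ x → f (F.suc x)) (λ x → f≢0 (F.suc x)))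

  -- the nonzero residues, enumerated as F.suc x for x : Fin q
  suc≢0# : ∀ (x : Fin q) → F.suc x ≢ 0#
  suc≢0# x ()

  scale : ∀ c → c ≢ 0# → Fin q → Fin q
  scale c c≢0 x = F.punchOut {i = F.zero} {j = c * F.suc x} (λ e → *-noZeroDivisors c≢0 (suc≢0# x) (sym e))

  scale-correct : ∀ c c≢0 x → F.suc (scale c c≢0 x) ≡ (c * F.suc x)
  scale-correct c c≢0 x = FinP.punchIn-punchOut {i = F.zero} _

  scale-inverse : ∀ c d → (c * d) ≡ 1# → ∀ (c≢0 : c ≢ 0#) (d≢0 : d ≢ 0#) x → scale c c≢0 (scale d d≢0 x) ≡ x
  scale-inverse c d cd≡1 c≢0 d≢0 x = FinP.suc-injective (begin
    F.suc (scale c c≢0 (scale d d≢0 x))   ≡⟨ scale-correct c c≢0 _ ⟩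
    c * F.suc (scale d d≢0 x)             ≡⟨ cong (c *_) (scale-correct d d≢0 x) ⟩
    c * (d * F.suc x)                     ≡⟨ sym (*-assoc c d _) ⟩
    (c * d) * F.suc x                     ≡⟨ cong (_* F.suc x) cd≡1 ⟩
    1# * F.suc x                          ≡⟨ *-identityˡ _ ⟩
    F.suc x                               ∎)
    where open ≡-Reasoning

  scale-permutation : ∀ a → a ≢ 0# → Permutation q q
  scale-permutation a a≢0 =
    permutation (scale a a≢0) (scale b b≢0) (scale-inverse a b ab≡1 a≢0 b≢0)
                (scale-inverse b a (trans (*-comm b a) ab≡1) b≢0 a≢0)
    where
    b : 𝔽
    b = proj₁ (inverse-exists a a≢0)
    ab≡1 : (a * b) ≡ 1#
    ab≡1 = proj₂ (inverse-exists a a≢0)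
    b≢0 : b ≢ 0#
    b≢0 e = 1#≢0# (trans (sym ab≡1) (trans (cong (a *_) e) (zeroʳ a)))

  -- Fermat's little theorem: P = ∏ x ≢ 0 equals ∏ a x = a^q P, and P ≢ 0
  fermat : ∀ (a : 𝔽) → a ≢ 0# → a ^ q ≡ 1#
  fermat a a≢0 = begin
    a ^ q                      ≡⟨ sym (*-identityʳ _) ⟩
    (a ^ q) * 1#               ≡⟨ cong ((a ^ q) *_) (sym (proj₂ P⁻¹)) ⟩
    (a ^ q) * (P * proj₁ P⁻¹)  ≡⟨ sym (*-assoc (a ^ q) P _) ⟩
    ((a ^ q) * P) * proj₁ P⁻¹  ≡⟨ cong (_* proj₁ P⁻¹) (sym P≡aᵠP) ⟩
    P * proj₁ P⁻¹              ≡⟨ proj₂ P⁻¹ ⟩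
    1#                         ∎
    where
    open ≡-Reasoning
    P : 𝔽
    P = Π.sum F.suc
    P⁻¹ : Σ 𝔽 (λ c → (P * c) ≡ 1#)
    P⁻¹ = inverse-exists P (product-nonzero F.suc suc≢0#)
    P≡aᵠP : P ≡ (a ^ q) * P
    P≡aᵠP = begin
      P                                   ≡⟨ Π.sum-permute F.suc (scale-permutation a a≢0) ⟩
      Π.sum (λ x → F.suc (scale a a≢0 x)) ≡⟨ Π.sum-cong-≗ (scale-correct a a≢0) ⟩
      Π.sum (λ x → a * F.suc x)           ≡⟨ Π.∑-distrib-+ (λ _ → a) F.suc ⟩
      Π.sum {q} (λ _ → a) * P             ≡⟨ cong (_* P) (product-const q a) ⟩
      (a ^ q) * P                         ∎

  ^-pred : ∀ a k → 1 ℕ.≤ k → ((a ^ (k ∸ 1)) * a) ≡ a ^ k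
  ^-pred a (suc k) _ = *-comm (a ^ k) a

  ⁻¹-inverseˡ : ∀ (a : 𝔽) → a ≢ 0# → ((a ⁻¹) * a) ≡ 1#
  ⁻¹-inverseˡ a a≢0 = begin
    [ toℕ a ℕ.^ (q ∸ 1) ] * a  ≡⟨ cong (_* a) (trans (^-hom (toℕ a) (q ∸ 1)) (cong (_^ (q ∸ 1)) ([toℕ] a))) ⟩
    (a ^ (q ∸ 1)) * a          ≡⟨ ^-pred a q (ℕP.≤-pred 1<p) ⟩
    a ^ q                      ≡⟨ fermat a a≢0 ⟩
    1#                         ∎
    where open ≡-Reasoning

module ZpLinear (p : ℕ) {{_ : NonZero p}} (1<p : 1 ℕ.< p) where

  open import Data.Vec as Vec using ([]; _∷_; lookup)
  open import Data.Vec.Properties using (lookup-map; lookup-zipWith; lookup-replicate; tabulate∘lookup; tabulate-cong)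
  open import Data.Fin.Properties using (_≟_)
  open import Relation.Nullary using (yes; no)
  import Algebra.Properties.Ring as RingProperties
  import Algebra.Properties.AbelianGroup as AbelianGroupProperties
  import Algebra.Properties.Semiring.Sum as SemiringSum

  open Zp p
  open ZpRing p 1<p
  open CommutativeRing commutativeRing
    using (+-abelianGroup; ring; semiring; +-identityʳ; *-identityʳ; zeroˡ; zeroʳ; distribʳ)
  private
    module R = RingProperties ring
    module AG = AbelianGroupProperties +-abelianGroup
    module S = SemiringSum semiring

  ∑ : ∀ {r} → (Fin r → 𝔽) → 𝔽
  ∑ = S.sum

  lookup-ext : ∀ {m} {u v : Vect m} → (∀ l → lookup u l ≡ lookup v l) → u ≡ v
  lookup-ext {u = u} {v} h = trans (sym (tabulate∘lookup u)) (trans (tabulate-cong h) (tabulate∘lookup v))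

  lookup-+ᵥ : ∀ {m} (u v : Vect m) l → lookup (u +ᵥ v) l ≡ (lookup u l + lookup v l)
  lookup-+ᵥ u v l = lookup-zipWith _+_ l u v

  lookup--ᵥ : ∀ {m} (u v : Vect m) l → lookup (u -ᵥ v) l ≡ (lookup u l - lookup v l)
  lookup--ᵥ u v l = lookup-zipWith _-_ l u v

  lookup-• : ∀ {m} c (v : Vect m) l → lookup (c • v) l ≡ (c * lookup v l)
  lookup-• c v l = lookup-map l (c *_) v

  lookup-0ᵥ : ∀ {m} (l : Fin m) → lookup (0ᵥ {m}) l ≡ 0#
  lookup-0ᵥ {m} l = lookup-replicate l 0#

  kernel⇒coord : ∀ {n m} (M : Mat n m) v → InKernel M v → ∀ k → (M ⟨ v ⟩ k) ≡ 0#
  kernel⇒coord M v Mv≡0 k = trans (cong (λ w → lookup w k) Mv≡0) (lookup-0ᵥ k)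

  coord⇒kernel : ∀ {n m} (M : Mat n m) v → (∀ k → (M ⟨ v ⟩ k) ≡ 0#) → InKernel M v
  coord⇒kernel M v h = lookup-ext (λ k → trans (h k) (sym (lookup-0ᵥ k)))

  x-0≡x : ∀ x → (x - 0#) ≡ x
  x-0≡x x = trans (cong (x +_) AG.ε⁻¹≈ε) (+-identityʳ x)

  x+y-y≡x : ∀ x y → ((x + y) - y) ≡ x
  x+y-y≡x x y = trans (+-assoc x y (- y)) (trans (cong (x +_) (-‿inverseʳ y)) (+-identityʳ x))

  -‿interchange : ∀ a b c d → ((a - b) + (c - d)) ≡ ((a + c) - (b + d))
  -‿interchange a b c d =
    trans (CommutativeSemigroupProperties.interchange a (- b) c (- d)) (cong ((a + c) +_) (AG.⁻¹-∙-comm b d))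
    where
    import Algebra.Properties.CommutativeSemigroup as CSP
    module CommutativeSemigroupProperties = CSP (CommutativeRing.+-commutativeSemigroup commutativeRing)

  ·-linear : ∀ {m} (u w h : Vect m) c → (u · (w -ᵥ (c • h))) ≡ ((u · w) - (c * (u · h)))
  ·-linear [] [] [] c = sym (trans (cong (0# +_) (trans (cong (λ t → - t) (zeroʳ c)) AG.ε⁻¹≈ε)) (+-identityʳ 0#))
  ·-linear (x ∷ u) (y ∷ w) (z ∷ h) c = begin
    (x * (y - (c * z))) + (u · (w -ᵥ (c • h)))          ≡⟨ cong₂ _+_ head-term (·-linear u w h c) ⟩
    ((x * y) - (c * (x * z))) + ((u · w) - (c * (u · h))) ≡⟨ -‿interchange (x * y) (c * (x * z)) (u · w) (c * (u · h)) ⟩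
    ((x * y) + (u · w)) - ((c * (x * z)) + (c * (u · h))) ≡⟨ cong (λ t → ((x * y) + (u · w)) - t) (sym (*-distribˡ-+ c (x * z) (u · h))) ⟩
    ((x * y) + (u · w)) - (c * ((x * z) + (u · h)))     ∎
    where
    open ≡-Reasoning
    head-term : (x * (y - (c * z))) ≡ ((x * y) - (c * (x * z)))
    head-term = trans (R.x[y-z]≈xy-xz x y (c * z))
      (cong (λ t → (x * y) - t) (trans (sym (*-assoc x c z)) (trans (cong (_* z) (*-comm x c)) (*-assoc c x z))))

  ⟨⟩-linear : ∀ {n m} (M : Mat n m) w h c k →
              (M ⟨ (w -ᵥ (c • h)) ⟩ k) ≡ ((M ⟨ w ⟩ k) - (c * (M ⟨ h ⟩ k)))
  ⟨⟩-linear M w h c k = trans (lookup-map k (_· _) M)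
    (trans (·-linear (lookup M k) w h c) (sym (cong₂ (λ a b → a - (c * b)) (lookup-map k (_· w) M) (lookup-map k (_· h) M))))

  lookup-lincomb : ∀ {r m} (c : Fin r → 𝔽) (B : Family r m) l →
                   lookup (lincomb c B) l ≡ ∑ (λ j → c j * lookup (B j) l)
  lookup-lincomb {zero}  c B l = lookup-0ᵥ l
  lookup-lincomb {suc r} c B l = trans (lookup-+ᵥ (c F.zero • B F.zero) _ l)
    (cong₂ _+_ (lookup-• (c F.zero) (B F.zero) l) (lookup-lincomb (λ j → c (F.suc j)) (λ j → B (F.suc j)) l))

  basis-≗ : ∀ {r m} {F G : Family r m} → (∀ j → F j ≡ G j) → IsBasis F → IsBasis G
  basis-≗ {F = F} {G} F≗G (indep , spans) =
    (λ c cG≡0 → indep c (trans (family-cong c) cG≡0)) ,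
    λ v → proj₁ (spans v) , trans (sym (family-cong (proj₁ (spans v)))) (proj₂ (spans v))
    where
    family-cong : ∀ c → lincomb c F ≡ lincomb c G
    family-cong c = cong (Vec.foldr _ _+ᵥ_ 0ᵥ) (tabulate-cong (λ j → cong (c j •_) (F≗G j)))

  ∑-zero : ∀ {r} (f : Fin r → 𝔽) → (∀ j → f j ≡ 0#) → ∑ f ≡ 0#
  ∑-zero {r} f f≗0 = trans (S.sum-cong-≗ f≗0) (S.sum-replicate-zero r)

  ∑-neg : ∀ {r} (f : Fin r → 𝔽) → ∑ (λ j → - f j) ≡ - ∑ f
  ∑-neg f = trans (S.sum-cong-≗ (λ j → sym (R.-1*x≈-x (f j))))
                  (trans (sym (S.*-distribˡ-sum (- 1#) f)) (R.-1*x≈-x (∑ f)))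

  shift : ∀ {r} → Fin r → 𝔽 → (Fin r → 𝔽) → Fin r → 𝔽
  shift F.zero    s e F.zero    = e F.zero + s
  shift F.zero    s e (F.suc j) = e (F.suc j)
  shift (F.suc h) s e F.zero    = e F.zero
  shift (F.suc h) s e (F.suc j) = shift h s (λ j' → e (F.suc j')) j

  shift-≢ : ∀ {r} (h j : Fin r) s e → j ≢ h → shift h s e j ≡ e j
  shift-≢ F.zero    F.zero    s e j≢h = ⊥-elim (j≢h refl)
  shift-≢ F.zero    (F.suc j) s e j≢h = refl
  shift-≢ (F.suc h) F.zero    s e j≢h = refl
  shift-≢ (F.suc h) (F.suc j) s e j≢h = shift-≢ h j s _ (λ e → j≢h (cong F.suc e))

  shift-0# : ∀ {r} (h j : Fin r) e → shift h 0# e j ≡ e j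
  shift-0# F.zero    F.zero    e = +-identityʳ (e F.zero)
  shift-0# F.zero    (F.suc j) e = refl
  shift-0# (F.suc h) F.zero    e = refl
  shift-0# (F.suc h) (F.suc j) e = shift-0# h j _

  ∑-shift : ∀ {r} (h : Fin r) s (e x : Fin r → 𝔽) →
            ∑ (λ j → shift h s e j * x j) ≡ (∑ (λ j → e j * x j) + (s * x h))
  ∑-shift {suc r} F.zero s e x = begin
    ((e₀ + s) * x₀) + rest          ≡⟨ cong (_+ rest) (distribʳ x₀ e₀ s) ⟩
    ((e₀ * x₀) + (s * x₀)) + rest   ≡⟨ +-assoc _ _ rest ⟩
    (e₀ * x₀) + ((s * x₀) + rest)   ≡⟨ cong ((e₀ * x₀) +_) (+-comm (s * x₀) rest) ⟩
    (e₀ * x₀) + (rest + (s * x₀))   ≡⟨ sym (+-assoc _ rest _) ⟩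
    ((e₀ * x₀) + rest) + (s * x₀)   ∎
    where
    open ≡-Reasoning
    e₀ x₀ rest : 𝔽
    e₀ = e F.zero
    x₀ = x F.zero
    rest = ∑ (λ j → e (F.suc j) * x (F.suc j))
  ∑-shift {suc r} (F.suc h) s e x = begin
    (e₀ * x₀) + ∑ (λ j → shift h s e' j * x' j)     ≡⟨ cong ((e₀ * x₀) +_) (∑-shift h s e' x') ⟩
    (e₀ * x₀) + (∑ (λ j → e' j * x' j) + (s * x' h)) ≡⟨ sym (+-assoc _ _ _) ⟩
    ((e₀ * x₀) + ∑ (λ j → e' j * x' j)) + (s * x' h) ∎
    where
    open ≡-Reasoning
    e₀ x₀ : 𝔽
    e₀ = e F.zero
    x₀ = x F.zero
    e' x' : Fin r → 𝔽
    e' = λ j → e (F.suc j)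
    x' = λ j → x (F.suc j)

  -- Subtracting multiples of one member F h from the other members of a
  -- family preserves being a basis: combinations of G are the combinations
  -- of F with the h-th coefficient shifted by the weight ∑ e j d j.
  module ElementaryTransformation {r m} (F G : Family r m) (h : Fin r) (d : Fin r → 𝔽)
    (d-h : d h ≡ 0#) (G-def : ∀ j → G j ≡ (F j -ᵥ (d j • F h))) where

    weight : (Fin r → 𝔽) → 𝔽
    weight e = ∑ (λ j → e j * d j)

    combination : ∀ e l → ∑ (λ j → e j * lookup (G j) l)
                          ≡ (∑ (λ j → e j * lookup (F j) l) - (weight e * lookup (F h) l))
    combination e l = begin
      ∑ (λ j → e j * lookup (G j) l)                                ≡⟨ S.sum-cong-≗ term ⟩
      ∑ (λ j → (e j * lookup (F j) l) + (- ((e j * d j) * Fₕ)))     ≡⟨ S.∑-distrib-+ (λ j → e j * lookup (F j) l) _ ⟩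
      ∑ (λ j → e j * lookup (F j) l) + ∑ (λ j → - ((e j * d j) * Fₕ)) ≡⟨ cong (∑ (λ j → e j * lookup (F j) l) +_) weighted ⟩
      ∑ (λ j → e j * lookup (F j) l) - (weight e * Fₕ)               ∎
      where
      open ≡-Reasoning
      Fₕ : 𝔽
      Fₕ = lookup (F h) l
      term : ∀ j → (e j * lookup (G j) l) ≡ ((e j * lookup (F j) l) + (- ((e j * d j) * Fₕ)))
      term j = begin
        e j * lookup (G j) l                             ≡⟨ cong (λ v → e j * lookup v l) (G-def j) ⟩
        e j * lookup (F j -ᵥ (d j • F h)) l              ≡⟨ cong (e j *_) (trans (lookup--ᵥ (F j) _ l) (cong (λ t → lookup (F j) l - t) (lookup-• (d j) (F h) l))) ⟩
        e j * (lookup (F j) l - (d j * Fₕ))              ≡⟨ R.x[y-z]≈xy-xz (e j) _ _ ⟩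
        (e j * lookup (F j) l) - (e j * (d j * Fₕ))      ≡⟨ cong (λ t → (e j * lookup (F j) l) - t) (sym (*-assoc (e j) (d j) Fₕ)) ⟩
        (e j * lookup (F j) l) + (- ((e j * d j) * Fₕ))  ∎
      weighted : ∑ (λ j → - ((e j * d j) * Fₕ)) ≡ (- (weight e * Fₕ))
      weighted = trans (∑-neg (λ j → (e j * d j) * Fₕ)) (cong (λ t → - t) (sym (S.*-distribʳ-sum Fₕ (λ j → e j * d j))))

    -- shifting the h-th coefficient does not change the weight, as d h = 0
    weight-shift : ∀ s e → weight (shift h s e) ≡ weight e
    weight-shift s e = trans (∑-shift h s e d) (trans (cong (λ t → weight e + (s * t)) d-h)
                         (trans (cong (weight e +_) (zeroʳ s)) (+-identityʳ (weight e))))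

    spans : Spans F → Spans G
    spans span-F v = e , lookup-ext λ l → begin
      lookup (lincomb e G) l                                        ≡⟨ lookup-lincomb e G l ⟩
      ∑ (λ j → e j * lookup (G j) l)                                ≡⟨ combination e l ⟩
      ∑ (λ j → e j * lookup (F j) l) - (weight e * lookup (F h) l)  ≡⟨ cong₂ (λ a b → a - (b * lookup (F h) l)) (∑-shift h s c (λ j → lookup (F j) l)) (weight-shift s c) ⟩
      (∑ (λ j → c j * lookup (F j) l) + (s * lookup (F h) l)) - (s * lookup (F h) l) ≡⟨ x+y-y≡x _ _ ⟩
      ∑ (λ j → c j * lookup (F j) l)                                ≡⟨ sym (lookup-lincomb c F l) ⟩
      lookup (lincomb c F) l                                        ≡⟨ cong (λ w → lookup w l) (proj₂ (span-F v)) ⟩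
      lookup v l                                                    ∎
      where
      open ≡-Reasoning
      c : Fin r → 𝔽
      c = proj₁ (span-F v)
      s : 𝔽
      s = weight c
      e : Fin r → 𝔽
      e = shift h s c

    independent : LinIndep F → LinIndep G
    independent indep-F e eG≡0 j = begin
      e j                        ≡⟨ sym (shift-0# h j e) ⟩
      shift h 0# e j             ≡⟨ cong (λ t → shift h t e j) (sym (trans (cong (λ t → - t) weight≡0) AG.ε⁻¹≈ε)) ⟩
      shift h (- weight e) e j   ≡⟨ e'≡0 j ⟩
      0#                         ∎
      where
      open ≡-Reasoning
      e' : Fin r → 𝔽
      e' = shift h (- weight e) e
      e'≡0 : ∀ j → e' j ≡ 0#
      e'≡0 = indep-F e' (lookup-ext λ l → begin
        lookup (lincomb e' F) l                                     ≡⟨ lookup-lincomb e' F l ⟩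
        ∑ (λ j → e' j * lookup (F j) l)                             ≡⟨ ∑-shift h _ e (λ j → lookup (F j) l) ⟩
        ∑ (λ j → e j * lookup (F j) l) + ((- weight e) * lookup (F h) l) ≡⟨ cong (∑ (λ j → e j * lookup (F j) l) +_) (sym (R.-‿distribˡ-* (weight e) _)) ⟩
        ∑ (λ j → e j * lookup (F j) l) - (weight e * lookup (F h) l) ≡⟨ sym (combination e l) ⟩
        ∑ (λ j → e j * lookup (G j) l)                              ≡⟨ sym (lookup-lincomb e G l) ⟩
        lookup (lincomb e G) l                                      ≡⟨ cong (λ w → lookup w l) eG≡0 ⟩
        lookup 0ᵥ l                                                 ∎)
      -- off h the coefficients of e and e' agree, and d h = 0
      weight≡0 : weight e ≡ 0#
      weight≡0 = ∑-zero _ λ j → case j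
        where
        case : ∀ j → (e j * d j) ≡ 0#
        case j with j ≟ h
        ... | yes refl = trans (cong (e j *_) d-h) (zeroʳ (e j))
        ... | no j≢h  = trans (cong (_* d j) (trans (sym (shift-≢ h j _ e j≢h)) (e'≡0 j))) (zeroˡ (d j))

    basis : IsBasis F → IsBasis G
    basis (indep-F , span-F) = independent indep-F , spans span-F

module Decisions where

  open import Data.Bool using (Bool; true; false; _∧_)
  open import Data.Maybe using (just; nothing)
  open import Data.Fin.Properties using (_≟_)
  open import Relation.Nullary using (Dec; yes; no; does)
  open import Relation.Nullary.Decidable using (dec-true; dec-false)

  does-true : ∀ {A : Set} (a? : Dec A) → does a? ≡ true → A
  does-true (yes a) _ = a

  does-false : ∀ {A : Set} (a? : Dec A) → does a? ≡ false → ¬ A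
  does-false (no ¬a) _ = ¬a

  true≢false : true ≢ false
  true≢false ()

  nothing≢just : ∀ {A : Set} {x : A} → nothing ≢ just x
  nothing≢just ()

  bool-cases : ∀ {A : Set} (b : Bool) → (b ≡ true → A) → (b ≡ false → A) → A
  bool-cases true  t f = t refl
  bool-cases false t f = f refl

  ∧-true : ∀ {a b : Bool} → (a ∧ b) ≡ true → (a ≡ true) × (b ≡ true)
  ∧-true {true} {true} _ = refl , refl

  first-just : ∀ {k} (f : Fin k → Bool) {x} → first f ≡ just x → f x ≡ true
  first-just {suc k} f e with f F.zero in f0
  first-just {suc k} f refl | true = f0
  ... | false with first (λ y → f (F.suc y)) in rest
  first-just {suc k} f refl | false | just y = first-just (λ y → f (F.suc y)) rest

  first-nothing : ∀ {k} (f : Fin k → Bool) → first f ≡ nothing → ∀ x → f x ≡ false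
  first-nothing {suc k} f e x with f F.zero in f0
  first-nothing {suc k} f () x | true
  ... | false with first (λ y → f (F.suc y)) in rest
  first-nothing {suc k} f refl F.zero    | false | nothing = f0
  first-nothing {suc k} f refl (F.suc x) | false | nothing = first-nothing (λ y → f (F.suc y)) rest x

  first-exists : ∀ {k} (f : Fin k → Bool) x → f x ≡ true → Σ (Fin k) (λ y → first f ≡ just y)
  first-exists f x fx with first f in e
  ... | just y  = y , refl
  ... | nothing = ⊥-elim (true≢false (trans (sym fx) (first-nothing f e x)))

  eqFin-true : ∀ {n} {a b : Fin n} → eqFin a b ≡ true → a ≡ b
  eqFin-true {a = a} {b} = does-true (a ≟ b)

  eqFin-false : ∀ {n} {a b : Fin n} → eqFin a b ≡ false → a ≢ b
  eqFin-false {a = a} {b} = does-false (a ≟ b)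

  eqFin-refl : ∀ {n} (a : Fin n) → eqFin a a ≡ true
  eqFin-refl a = dec-true (a ≟ a) refl

  eqFin-≢ : ∀ {n} {a b : Fin n} → a ≢ b → eqFin a b ≡ false
  eqFin-≢ {a = a} {b} = dec-false (a ≟ b)

module ZpDecisions (p : ℕ) {{_ : NonZero p}} (1<p : 1 ℕ.< p) where

  open import Data.Bool using (Bool; true; false; not; _∧_)
  open import Data.Bool.Properties using (not-injective)
  open import Data.Maybe using (just; nothing)
  open import Data.Fin.Properties using (_≟_)
  open import Relation.Nullary using (yes; no)
  open import Relation.Nullary.Decidable using (dec-false)
  open Decisions

  open Zp p
  open ZpLinear p 1<p using (kernel⇒coord; coord⇒kernel)

  Sᵇ-true : ∀ {n m} (M : Mat n m) v k → Sᵇ M v k ≡ true → k ∈S[ M ] v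
  Sᵇ-true M v k e = does-false ((M ⟨ v ⟩ k) ≟ 0#) (not-injective e)

  Sᵇ-false : ∀ {n m} (M : Mat n m) v k → Sᵇ M v k ≡ false → (M ⟨ v ⟩ k) ≡ 0#
  Sᵇ-false M v k e = does-true ((M ⟨ v ⟩ k) ≟ 0#) (not-injective e)

  ∈S⇒Sᵇ : ∀ {n m} (M : Mat n m) v k → k ∈S[ M ] v → Sᵇ M v k ≡ true
  ∈S⇒Sᵇ M v k s = cong not (dec-false ((M ⟨ v ⟩ k) ≟ 0#) s)

  ∉S⇒≡0# : ∀ {n m} (M : Mat n m) v k → ¬ (k ∈S[ M ] v) → (M ⟨ v ⟩ k) ≡ 0#
  ∉S⇒≡0# M v k ¬s with (M ⟨ v ⟩ k) ≟ 0#
  ... | yes z = z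
  ... | no nz = ⊥-elim (¬s nz)

  inKᵇ-true : ∀ {n m} (M : Mat n m) v → inKᵇ M v ≡ true → InKernel M v
  inKᵇ-true {n} M v e with first {n} (Sᵇ M v) in none
  ... | nothing = coord⇒kernel M v (λ k → Sᵇ-false M v k (first-nothing (Sᵇ M v) none k))

  inKᵇ-false : ∀ {n m} (M : Mat n m) v → inKᵇ M v ≡ false → ¬ InKernel M v
  inKᵇ-false {n} M v e Mv≡0 with first {n} (Sᵇ M v) in some
  ... | just k = Sᵇ-true M v k (first-just (Sᵇ M v) some) (kernel⇒coord M v Mv≡0 k)

  uniqueᵇ-true : ∀ {r n m} (M : Mat n m) (F : Family r m) j k → uniqueᵇ M F j k ≡ true → Unique M F j k
  uniqueᵇ-true {r} M F j k e with Sᵇ M (F j) k in s | first {r} (λ j' → not (eqFin j' j) ∧ Sᵇ M (F j') k) in none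
  ... | true | nothing = Sᵇ-true M (F j) k s , other
    where
    other : ∀ j' → j' ≢ j → ¬ (k ∈S[ M ] F j')
    other j' j'≢j s' with first-nothing _ none j'
    ... | e' rewrite eqFin-≢ j'≢j | ∈S⇒Sᵇ M (F j') k s' = true≢false e'

  Unique⇒uniqueᵇ : ∀ {r n m} (M : Mat n m) (F : Family r m) j k → Unique M F j k → uniqueᵇ M F j k ≡ true
  Unique⇒uniqueᵇ {r} M F j k (s , only) with first {r} (λ j' → not (eqFin j' j) ∧ Sᵇ M (F j') k) in some
  ... | nothing rewrite ∈S⇒Sᵇ M (F j) k s = refl
  ... | just j' with eqFin j' j in j'≟j | Sᵇ M (F j') k in s' | first-just _ some
  ...   | false | true  | _ = ⊥-elim (only j' (eqFin-false j'≟j) (Sᵇ-true M (F j') k s'))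

  pc-just : ∀ {r n m} (M : Mat n m) (F : Family r m) j {k} → pc M F j ≡ just k → Unique M F j k
  pc-just M F j {k} e = uniqueᵇ-true M F j k (first-just (uniqueᵇ M F j) e)

  pc-exists : ∀ {r n m} (M : Mat n m) (F : Family r m) j k → Unique M F j k → Σ (Fin n) (λ k' → pc M F j ≡ just k')
  pc-exists M F j k u = first-exists (uniqueᵇ M F j) k (Unique⇒uniqueᵇ M F j k u)

module Elimination (p : ℕ) {{_ : NonZero p}} (1<p : 1 ℕ.< p)
  (⁻¹-inverseˡ : ∀ (a : Fin p) → a ≢ Zp.0# p → Zp._*_ p (Zp._⁻¹ p a) a ≡ ZpRing.1# p 1<p) where

  open import Data.Bool using (Bool; true; false; if_then_else_)
  open import Data.Vec using (lookup)
  open import Data.Fin.Properties using (_≟_)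
  open import Relation.Nullary using (yes; no)

  open Zp p
  open ZpRing p 1<p
  open ZpLinear p 1<p
  open Decisions using (true≢false)
  open ZpDecisions p 1<p using (∉S⇒≡0#)
  open CommutativeRing commutativeRing using (zeroˡ; zeroʳ; *-identityʳ)

  eliminate : ∀ {n m} → Mat n m → Fin n → Vect m → Vect m → Vect m
  eliminate M k h w = w -ᵥ (((M ⟨ w ⟩ k) * ((M ⟨ h ⟩ k) ⁻¹)) • h)

  Settled : ∀ {r n m} → Mat n m → Family r m → Fin r → Set
  Settled {n = n} M F j = InKernel M (F j) ⊎ Σ (Fin n) (Unique M F j)

  settled-≗ : ∀ {r n m} (M : Mat n m) {F G : Family r m} → (∀ j → F j ≡ G j) → ∀ j → Settled M F j → Settled M G j
  settled-≗ M F≗G j (inj₁ ker) = inj₁ (subst (InKernel M) (F≗G j) ker)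
  settled-≗ M F≗G j (inj₂ (k , s , only)) = inj₂ (k , subst (k ∈S[ M ]_) (F≗G j) s ,
    λ j' j'≢j s' → only j' j'≢j (subst (k ∈S[ M ]_) (sym (F≗G j')) s'))

  settled⇒good : ∀ {r n m} (M : Mat n m) (F : Family r m) → (∀ j → Settled M F j) → Good M F
  settled⇒good M F settled j ¬ker with settled j
  ... | inj₁ ker    = ⊥-elim (¬ker ker)
  ... | inj₂ unique = unique

  module PivotElimination {r n m} (M : Mat n m) (F G : Family r m) (h : Fin r) (k : Fin n)
    (pivot : k ∈S[ M ] F h) (c : Fin r → Bool)
    (G-def : ∀ j → G j ≡ (if c j then eliminate M k (F h) (F j) else F j))
    (c-h : c h ≡ false) (c-support : ∀ j → j ≢ h → k ∈S[ M ] F j → c j ≡ true) where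

    y : 𝔽
    y = M ⟨ F h ⟩ k

    d : Fin r → 𝔽
    d j = if c j then (M ⟨ F j ⟩ k) * (y ⁻¹) else 0#

    G-elementary : ∀ j → G j ≡ (F j -ᵥ (d j • F h))
    G-elementary j with c j | G-def j
    ... | true  | e = e
    ... | false | e = trans e (lookup-ext λ l → sym (begin
      lookup (F j -ᵥ (0# • F h)) l       ≡⟨ lookup--ᵥ (F j) _ l ⟩
      lookup (F j) l - lookup (0# • F h) l ≡⟨ cong (λ t → lookup (F j) l - t) (trans (lookup-• 0# (F h) l) (zeroˡ _)) ⟩
      lookup (F j) l - 0#                ≡⟨ x-0≡x _ ⟩
      lookup (F j) l                     ∎))
      where open ≡-Reasoning

    d-h : d h ≡ 0#
    d-h rewrite c-h = refl

    G-h : G h ≡ F h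
    G-h = trans (G-def h) (cong (λ b → if b then _ else F h) c-h)

    image : ∀ j k' → (M ⟨ G j ⟩ k') ≡ ((M ⟨ F j ⟩ k') - (d j * (M ⟨ F h ⟩ k')))
    image j k' = trans (cong (λ v → M ⟨ v ⟩ k') (G-elementary j)) (⟨⟩-linear M (F j) (F h) (d j) k')

    d-pivot : ∀ j → j ≢ h → (d j * y) ≡ (M ⟨ F j ⟩ k)
    d-pivot j j≢h with c j in cj
    ... | true  = trans (*-assoc (M ⟨ F j ⟩ k) (y ⁻¹) y)
                    (trans (cong ((M ⟨ F j ⟩ k) *_) (⁻¹-inverseˡ y pivot)) (*-identityʳ (M ⟨ F j ⟩ k)))
    ... | false = trans (zeroˡ y) (sym (∉S⇒≡0# M (F j) k λ s → true≢false (trans (sym (c-support j j≢h s)) cj)))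

    d-zero : ∀ j → (M ⟨ F j ⟩ k) ≡ 0# → d j ≡ 0#
    d-zero j z with c j
    ... | true  = trans (cong (_* (y ⁻¹)) z) (zeroˡ (y ⁻¹))
    ... | false = refl

    G-k : ∀ j → j ≢ h → (M ⟨ G j ⟩ k) ≡ 0#
    G-k j j≢h = trans (image j k) (trans (cong (λ t → (M ⟨ F j ⟩ k) - t) (d-pivot j j≢h)) (-‿inverseʳ _))

    G-off : ∀ j k' → (M ⟨ F h ⟩ k') ≡ 0# → (M ⟨ G j ⟩ k') ≡ (M ⟨ F j ⟩ k')
    G-off j k' z = trans (image j k') (trans (cong (λ t → (M ⟨ F j ⟩ k') - (d j * t)) z)
                     (trans (cong (λ t → (M ⟨ F j ⟩ k') - t) (zeroʳ (d j))) (x-0≡x _)))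

    basis : IsBasis F → IsBasis G
    basis = ElementaryTransformation.basis F G h d d-h G-elementary

    pivot-unique : Unique M G h k
    pivot-unique = (λ z → pivot (trans (cong (λ v → M ⟨ v ⟩ k) (sym G-h)) z)) , λ j j≢h s → s (G-k j j≢h)

    kernel-preserved : ∀ j → InKernel M (F j) → InKernel M (G j)
    kernel-preserved j ker = coord⇒kernel M (G j) λ k' → begin
      M ⟨ G j ⟩ k'                             ≡⟨ image j k' ⟩
      (M ⟨ F j ⟩ k') - (d j * (M ⟨ F h ⟩ k'))  ≡⟨ cong₂ (λ a b → a - (b * (M ⟨ F h ⟩ k'))) (kernel⇒coord M (F j) ker k') (d-zero j (kernel⇒coord M (F j) ker k)) ⟩
      0# - (0# * (M ⟨ F h ⟩ k'))               ≡⟨ cong (λ t → 0# - t) (zeroˡ _) ⟩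
      0# - 0#                                  ≡⟨ x-0≡x 0# ⟩
      0#                                       ∎
      where open ≡-Reasoning

    -- a k'-unique member F j (j ≠ h) has F h vanishing at k', so nothing changes at k'
    unique-preserved : ∀ j k' → j ≢ h → Unique M F j k' → Unique M G j k'
    unique-preserved j k' j≢h (s , only) =
      (λ z → s (trans (sym (G-off j k' Fh≡0)) z)) , λ j' j'≢j s' → only j' j'≢j (λ z → s' (trans (G-off j' k' Fh≡0) z))
      where
      Fh≡0 : (M ⟨ F h ⟩ k') ≡ 0#
      Fh≡0 = ∉S⇒≡0# M (F h) k' (only h (λ e → j≢h (sym e)))

    settled-preserved : ∀ j → j ≢ h → Settled M F j → Settled M G j
    settled-preserved j j≢h (inj₁ ker)          = inj₁ (kernel-preserved j ker)
    settled-preserved j j≢h (inj₂ (k' , unique)) = inj₂ (k' , unique-preserved j k' j≢h unique)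

    joins-kernel : ∀ j → j ≢ h → (∀ k' → k' ≢ k → (M ⟨ F h ⟩ k') ≡ 0#) →
                   (∀ k' → k' ≢ k → (M ⟨ F j ⟩ k') ≡ 0#) → InKernel M (G j)
    joins-kernel j j≢h h-off j-off = coord⇒kernel M (G j) λ k' → case k'
      where
      case : ∀ k' → (M ⟨ G j ⟩ k') ≡ 0#
      case k' with k' ≟ k
      ... | yes refl = G-k j j≢h
      ... | no k'≢k = trans (G-off j k' (h-off k' k'≢k)) (j-off k' k'≢k)

-- Correctness of the procedure (V, u, û, v̂ as in its definition):
--   * classify: every member of B is already settled w.r.t. A', or lies
--     in V, or is u (the members of B outside K keep their uniqueness off
--     row i, and A' agrees with A off row i);
--   * step (1) is an elimination in row i against v̂ (if v̂ exists); after
--     it every member except û is settled: the other members of V join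
--     the kernel of A', settled members stay settled;
--   * step (2) settles û: either û lies in the kernel of A', or it becomes
--     the pivot of an elimination in its least support row.
module ProcedureAnalysis (p : ℕ) {{_ : NonZero p}} (1<p : 1 ℕ.< p)
  (⁻¹-inverseˡ : ∀ (a : Fin p) → a ≢ Zp.0# p → Zp._*_ p (Zp._⁻¹ p a) a ≡ ZpRing.1# p 1<p)
  {n m r : ℕ} (A A' : Zp.Mat p n m) (i : Fin n)
  (rows-agree : ∀ (k : Fin n) (l : Fin m) → k ≢ i → Zp.entry p A' k l ≡ Zp.entry p A k l)
  {_≺_ : Rel (Zp.Vect p m) 0ℓ} (ord : IsStrictTotalOrder _≡_ _≺_)
  (B : Zp.Family p r m) (good-B : Zp.Good p A B) where

  open import Data.Bool using (Bool; true; false; not; _∧_; _∨_; if_then_else_)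
  open import Data.Maybe using (Maybe; just; nothing)
  open import Data.Maybe.Properties using (just-injective)
  open import Data.Vec using (lookup)
  open import Data.Vec.Properties using (lookup-map)
  open import Data.Fin.Properties using (_≟_)
  open import Relation.Nullary using (yes; no)
  open import Function using (_∘_)
  open import Relation.Binary using (tri<; tri≈; tri>)

  open Zp p
  open ZpLinear p 1<p using (lookup-ext; kernel⇒coord; coord⇒kernel; basis-≗)
  open Decisions
  open ZpDecisions p 1<p
  open Elimination p 1<p ⁻¹-inverseˡ
  open Procedure A A' i ord B

  image-off-i : ∀ v k → k ≢ i → (A' ⟨ v ⟩ k) ≡ (A ⟨ v ⟩ k)
  image-off-i v k k≢i = trans (lookup-map k (_· v) A')
    (trans (cong (_· v) (lookup-ext {u = lookup A' k} {lookup A k} (λ l → rows-agree k l k≢i))) (sym (lookup-map k (_· v) A)))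

  unique-off-i : ∀ (F : Family r m) j k → k ≢ i → Unique A F j k → Unique A' F j k
  unique-off-i F j k k≢i (s , only) =
    (λ z → s (trans (sym (image-off-i (F j) k k≢i)) z)) ,
    λ j' j'≢j s' → only j' j'≢j (λ z → s' (trans (image-off-i (F j') k k≢i) z))

  kernel-off-i : ∀ v → inKᵇ A v ≡ true → ∀ k → k ≢ i → (A' ⟨ v ⟩ k) ≡ 0#
  kernel-off-i v ker k k≢i = trans (image-off-i v k k≢i) (kernel⇒coord A v (inKᵇ-true A v ker) k)

  minBy-just : ∀ {s} (g : Fin s → Fin r) P {j} → minBy g P ≡ just j → P j ≡ true
  minBy-just {suc s} g P e with minBy (g ∘ F.suc) P in rest | P (g F.zero) in here
  ... | _ | false = minBy-just (g ∘ F.suc) P (trans rest e)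
  minBy-just {suc s} g P refl | nothing | true = here
  ... | just j' | true with IsStrictTotalOrder.compare ord (B (g F.zero)) (B j')
  minBy-just {suc s} g P refl | just j' | true | tri< _ _ _ = here
  minBy-just {suc s} g P refl | just j' | true | tri≈ _ _ _ = here
  minBy-just {suc s} g P refl | just j' | true | tri> _ _ _ = minBy-just (g ∘ F.suc) P rest

  minBy-nothing : ∀ {s} (g : Fin s → Fin r) P → minBy g P ≡ nothing → ∀ x → P (g x) ≡ false
  minBy-nothing {suc s} g P e x with minBy (g ∘ F.suc) P in rest | P (g F.zero) in here
  minBy-nothing {suc s} g P e F.zero    | _ | false = here
  minBy-nothing {suc s} g P e (F.suc x) | _ | false = minBy-nothing (g ∘ F.suc) P (trans rest e) x
  ... | just j' | true with IsStrictTotalOrder.compare ord (B (g F.zero)) (B j')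
  minBy-nothing {suc s} g P () x | just j' | true | tri< _ _ _
  minBy-nothing {suc s} g P () x | just j' | true | tri≈ _ _ _
  minBy-nothing {suc s} g P () x | just j' | true | tri> _ _ _

  V-empty : vmin? ≡ nothing → ∀ j → inV j ≡ false
  V-empty = minBy-nothing (λ j → j) inV

  pc≡i⇒pcIsI : ∀ j → pc A B j ≡ just i → pcIsI j ≡ true
  pc≡i⇒pcIsI j e with pc A B j
  pc≡i⇒pcIsI j refl | just _ = eqFin-refl i

  pcIsI⇒pc≡i : ∀ j → pcIsI j ≡ true → pc A B j ≡ just i
  pcIsI⇒pc≡i j e with pc A B j
  ... | just k = cong just (eqFin-true e)

  u-unique : ∀ {ju} → u? ≡ just ju → Unique A B ju i
  u-unique {ju} e = pc-just A B ju (pcIsI⇒pc≡i ju (first-just pcIsI e))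

  u∉K : ∀ {ju} → u? ≡ just ju → inKᵇ A (B ju) ≡ false
  u∉K {ju} e with inKᵇ A (B ju) in ker
  ... | false = refl
  ... | true  = ⊥-elim (proj₁ (u-unique e) (kernel⇒coord A (B ju) (inKᵇ-true A (B ju) ker) i))

  data Kind (j : Fin r) : Set where
    settled : Settled A' B j → Kind j
    in-V    : inV j ≡ true → Kind j
    is-u    : u? ≡ just j → Kind j

  classify : ∀ j → Kind j
  classify j with inKᵇ A (B j) in ker | S'ᵇ (B j) i in s
  ... | true | true  = in-V (cong₂ _∧_ ker s)
  ... | true | false = settled (inj₁ (coord⇒kernel A' (B j) vanishes))
    where
    vanishes : ∀ k → (A' ⟨ B j ⟩ k) ≡ 0#
    vanishes k with k ≟ i
    ... | yes refl = Sᵇ-false A' (B j) i s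
    ... | no k≢i  = kernel-off-i (B j) ker k k≢i
  ... | false | _ with good-B j (inKᵇ-false A (B j) ker)
  ...   | k , unique with pc-exists A B j k unique
  ...     | k₀ , pc≡k₀ with k₀ ≟ i
  ...       | no k₀≢i = settled (inj₂ (k₀ , unique-off-i B j k₀ k₀≢i (pc-just A B j pc≡k₀)))
  ...       | yes refl with first-exists pcIsI j (pc≡i⇒pcIsI j pc≡k₀)
  ...         | ju , u≡ju with j ≟ ju
  ...           | yes refl = is-u u≡ju
  ...           | no j≢ju = ⊥-elim (proj₂ (u-unique u≡ju) j j≢ju (proj₁ (pc-just A B j pc≡k₀)))

  Uᵇ-of-u : ∀ {ju} → u? ≡ just ju → Uᵇ ≡ S'ᵇ (B ju) i
  Uᵇ-of-u e with u?
  Uᵇ-of-u refl | just _ = refl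

  Uᵇ-no-u : u? ≡ nothing → Uᵇ ≡ false
  Uᵇ-no-u e with u?
  Uᵇ-no-u refl | nothing = refl

  isU-of-u : ∀ {ju} → u? ≡ just ju → ∀ j → isU j ≡ eqFin j ju
  isU-of-u e j with u?
  isU-of-u refl j | just _ = refl

  isU-no-u : u? ≡ nothing → ∀ j → isU j ≡ false
  isU-no-u e j with u?
  isU-no-u refl j | nothing = refl

  vhat-of-V : ∀ {h} → vmin? ≡ just h → vhat? ≡ just h
  vhat-of-V e with vmin?
  vhat-of-V refl | just _ = refl

  vhat-of-u : ∀ {ju} → vmin? ≡ nothing → u? ≡ just ju → S'ᵇ (B ju) i ≡ true → vhat? ≡ just ju
  vhat-of-u ev eu es with vmin?
  vhat-of-u refl eu es | nothing = trans (cong (λ b → if b then u? else nothing) (trans (Uᵇ-of-u eu) es)) eu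

  vhat-none : vmin? ≡ nothing → (∀ ju → u? ≡ just ju → S'ᵇ (B ju) i ≡ false) → vhat? ≡ nothing
  vhat-none ev no-U with vmin?
  vhat-none refl no-U | nothing = cong (λ b → if b then u? else nothing) (no-U' u? refl)
    where
    no-U' : ∀ x → u? ≡ x → Uᵇ ≡ false
    no-U' nothing   eu = Uᵇ-no-u eu
    no-U' (just ju) eu = trans (Uᵇ-of-u eu) (no-U ju eu)

  uhat-of-V : ∀ {ju} → Vᵇ ≡ true → u? ≡ just ju → uhat? ≡ just ju
  uhat-of-V eV eu with u?
  uhat-of-V eV refl | just ju rewrite eV with S'ᵇ (B ju) i
  ... | true  = refl
  ... | false = refl

  uhat-unchanged : ∀ {ju} → u? ≡ just ju → S'ᵇ (B ju) i ≡ false → uhat? ≡ just ju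
  uhat-unchanged eu es with u?
  uhat-unchanged refl es | just _ rewrite es = refl

  select : Fin r → Fin r → Bool
  select h j = inW j ∨ (Vᵇ ∧ inV j ∧ not (eqFin j h)) ∨ (Vᵇ ∧ Uᵇ ∧ isU j)

  step1-at : ∀ {h} → vhat? ≡ just h → ∀ j → step1 j ≡ (if select h j then eliminate A' i (B h) (B j) else B j)
  step1-at e j with vhat?
  step1-at refl j | just _ = refl

  step1-none : vhat? ≡ nothing → ∀ j → step1 j ≡ B j
  step1-none e j with vhat?
  step1-none refl j | nothing = refl

  result-none : uhat? ≡ nothing → result ≡ step1
  result-none e with uhat?
  result-none refl | nothing = refl

  result-kernel : ∀ {ju} → uhat? ≡ just ju → first (S'ᵇ (step1 ju)) ≡ nothing → result ≡ step1
  result-kernel eu ek with uhat?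
  result-kernel refl ek | just ju with first (S'ᵇ (step1 ju))
  result-kernel refl refl | just ju | nothing = refl

  result-at : ∀ {ju k} → uhat? ≡ just ju → first (S'ᵇ (step1 ju)) ≡ just k → ∀ j →
              result j ≡ (if not (eqFin j ju) ∧ S'ᵇ (step1 j) k then eliminate A' k (step1 ju) (step1 j) else step1 j)
  result-at eu ek j with uhat?
  result-at refl ek j | just ju with first (S'ᵇ (step1 ju))
  result-at refl refl j | just ju | just k = refl

  -- select h j as a Boolean function of the tests it is built from;
  -- the facts below are checked by evaluation
  shape : (k s u e v w : Bool) → Bool
  shape k s u e v w = (not k ∧ s ∧ not u) ∨ (v ∧ (k ∧ s) ∧ not e) ∨ (v ∧ w ∧ u)

  select-shape : ∀ h j → select h j ≡ shape (inKᵇ A (B j)) (S'ᵇ (B j) i) (isU j) (eqFin j h) Vᵇ Uᵇ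
  select-shape h j = refl

  shape-pivot-V : ∀ {k s u e v w} → k ≡ true → s ≡ true → u ≡ false → e ≡ true → v ≡ true → shape k s u e v w ≡ false
  shape-pivot-V {w = true}  refl refl refl refl refl = refl
  shape-pivot-V {w = false} refl refl refl refl refl = refl

  shape-pivot-u : ∀ {k s u e v w} → k ≡ false → s ≡ true → u ≡ true → v ≡ false → shape k s u e v w ≡ false
  shape-pivot-u refl refl refl refl = refl

  shape-V : ∀ {k s u e v w} → k ≡ true → s ≡ true → e ≡ false → v ≡ true → shape k s u e v w ≡ true
  shape-V refl refl refl refl = refl

  shape-W : ∀ {k s u e v w} → k ≡ false → s ≡ true → u ≡ false → shape k s u e v w ≡ true
  shape-W refl refl refl = refl

  shape-u : ∀ {k s u e v w} → k ≡ false → s ≡ true → u ≡ true → v ≡ true → w ≡ true → shape k s u e v w ≡ true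
  shape-u refl refl refl refl refl = refl

  isU⇒u : ∀ j → isU j ≡ true → u? ≡ just j
  isU⇒u j t = from-u? u? refl
    where
    from-u? : ∀ x → u? ≡ x → u? ≡ just j
    from-u? nothing   eu = ⊥-elim (true≢false (trans (sym t) (isU-no-u eu j)))
    from-u? (just ju) eu = trans eu (cong just (sym (eqFin-true (trans (sym (isU-of-u eu j)) t))))

  Step1Correct : Set
  Step1Correct = IsBasis step1 × (∀ j → uhat? ≢ just j → Settled A' step1 j)

  -- case V ≠ ∅: v̂ = min V is the pivot, the other members of V join the kernel
  step1-pivot-in-V : ∀ {h} → vmin? ≡ just h → IsBasis B → Step1Correct
  step1-pivot-in-V {h} ev basis-B = E.basis basis-B , all-but-û
    where
    h∈K : inKᵇ A (B h) ≡ true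
    h∈K = proj₁ (∧-true (minBy-just (λ j → j) inV ev))
    i∈S'h : S'ᵇ (B h) i ≡ true
    i∈S'h = proj₂ (∧-true (minBy-just (λ j → j) inV ev))
    V≢∅ : Vᵇ ≡ true
    V≢∅ = cong isJust ev
    h≢u : isU h ≡ false
    h≢u = from-u? u? refl
      where
      from-u? : ∀ x → u? ≡ x → isU h ≡ false
      from-u? nothing   eu = isU-no-u eu h
      from-u? (just ju) eu = trans (isU-of-u eu h)
        (eqFin-≢ λ h≡ju → true≢false (trans (sym h∈K) (subst (λ x → inKᵇ A (B x) ≡ false) (sym h≡ju) (u∉K eu))))
    selects-support : ∀ j → j ≢ h → i ∈S[ A' ] B j → select h j ≡ true
    selects-support j j≢h s = trans (select-shape h j) (bool-cases (inKᵇ A (B j))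
      (λ ker → shape-V {u = isU j} {w = Uᵇ} ker i∈S'j (eqFin-≢ j≢h) V≢∅)
      (λ ker → bool-cases (isU j)
        (λ isu → shape-u {e = eqFin j h} ker i∈S'j isu V≢∅ (trans (Uᵇ-of-u (isU⇒u j isu)) i∈S'j))
        (λ isu → shape-W {e = eqFin j h} {v = Vᵇ} {w = Uᵇ} ker i∈S'j isu)))
      where
      i∈S'j : S'ᵇ (B j) i ≡ true
      i∈S'j = ∈S⇒Sᵇ A' (B j) i s
    module E = PivotElimination A' B step1 h i (Sᵇ-true A' (B h) i i∈S'h) (select h) (step1-at (vhat-of-V ev))
                 (trans (select-shape h h) (shape-pivot-V {w = Uᵇ} h∈K i∈S'h h≢u (eqFin-refl h) V≢∅)) selects-support
    all-but-û : ∀ j → uhat? ≢ just j → Settled A' step1 j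
    all-but-û j û≢j with j ≟ h
    ... | yes refl = inj₂ (i , E.pivot-unique)
    ... | no j≢h with classify j
    ...   | settled s = E.settled-preserved j j≢h s
    ...   | in-V j∈V  = inj₁ (E.joins-kernel j j≢h (kernel-off-i (B h) h∈K) (kernel-off-i (B j) (proj₁ (∧-true j∈V))))
    ...   | is-u u≡j  = ⊥-elim (û≢j (uhat-of-V V≢∅ u≡j))

  -- case V = ∅, i ∈ S'(u): v̂ = u is the pivot and û is not defined
  step1-pivot-is-u : ∀ {ju} → vmin? ≡ nothing → u? ≡ just ju → S'ᵇ (B ju) i ≡ true → IsBasis B → Step1Correct
  step1-pivot-is-u {ju} ev eu i∈S'u basis-B = E.basis basis-B , λ j _ → all j
    where
    selects-support : ∀ j → j ≢ ju → i ∈S[ A' ] B j → select ju j ≡ true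
    selects-support j j≢ju s = trans (select-shape ju j) (bool-cases (inKᵇ A (B j))
      (λ ker → ⊥-elim (true≢false (trans (sym (cong₂ _∧_ ker i∈S'j)) (V-empty ev j))))
      (λ ker → shape-W {e = eqFin j ju} {v = Vᵇ} {w = Uᵇ} ker i∈S'j (trans (isU-of-u eu j) (eqFin-≢ j≢ju))))
      where
      i∈S'j : S'ᵇ (B j) i ≡ true
      i∈S'j = ∈S⇒Sᵇ A' (B j) i s
    module E = PivotElimination A' B step1 ju i (Sᵇ-true A' (B ju) i i∈S'u) (select ju) (step1-at (vhat-of-u ev eu i∈S'u))
                 (trans (select-shape ju ju) (shape-pivot-u {e = eqFin ju ju} {w = Uᵇ} (u∉K eu) i∈S'u
                   (trans (isU-of-u eu ju) (eqFin-refl ju)) (cong isJust ev)))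
                 selects-support
    all : ∀ j → Settled A' step1 j
    all j with j ≟ ju
    ... | yes refl = inj₂ (i , E.pivot-unique)
    ... | no j≢ju with classify j
    ...   | settled s = E.settled-preserved j j≢ju s
    ...   | in-V j∈V  = ⊥-elim (true≢false (trans (sym j∈V) (V-empty ev j)))
    ...   | is-u u≡j  = ⊥-elim (j≢ju (just-injective (trans (sym u≡j) eu)))

  -- case v̂ undefined: step (1) changes nothing, and every member but u = û is settled
  step1-no-pivot : vmin? ≡ nothing → (∀ ju → u? ≡ just ju → S'ᵇ (B ju) i ≡ false) → IsBasis B → Step1Correct
  step1-no-pivot ev no-U basis-B = basis-≗ B≗step1 basis-B , λ j û≢j → settled-≗ A' B≗step1 j (by-kind j û≢j)
    where
    B≗step1 : ∀ j → B j ≡ step1 j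
    B≗step1 j = sym (step1-none (vhat-none ev no-U) j)
    by-kind : ∀ j → uhat? ≢ just j → Settled A' B j
    by-kind j û≢j with classify j
    ... | settled s = s
    ... | in-V j∈V  = ⊥-elim (true≢false (trans (sym j∈V) (V-empty ev j)))
    ... | is-u u≡j  = ⊥-elim (û≢j (uhat-unchanged u≡j (no-U j u≡j)))

  step1-correct : IsBasis B → Step1Correct
  step1-correct basis-B = by-V vmin? refl
    where
    by-V : ∀ x → vmin? ≡ x → Step1Correct
    by-V (just h) ev = step1-pivot-in-V ev basis-B
    by-V nothing  ev = by-u u? refl
      where
      by-u : ∀ x → u? ≡ x → Step1Correct
      by-u nothing   eu = step1-no-pivot ev (λ ju e → ⊥-elim (nothing≢just (trans (sym eu) e))) basis-B
      by-u (just ju) eu = bool-cases (S'ᵇ (B ju) i)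
        (λ i∈S'u → step1-pivot-is-u ev eu i∈S'u basis-B)
        (λ i∉S'u → step1-no-pivot ev (λ ju' e → subst (λ x → S'ᵇ (B x) i ≡ false) (just-injective (trans (sym eu) e)) i∉S'u) basis-B)

  Correct : Family r m → Set
  Correct F = IsBasis F × Good A' F

  step2-correct : ∀ {ju} → uhat? ≡ just ju → IsBasis step1 → (∀ j → j ≢ ju → Settled A' step1 j) → Correct result
  step2-correct {ju} eû basis1 others = by-k (first (S'ᵇ (step1 ju))) refl
    where
    by-k : ∀ x → first (S'ᵇ (step1 ju)) ≡ x → Correct result
    -- S'(û) = ∅: û lies in the kernel of A' and nothing changes
    by-k nothing ek = subst Correct (sym (result-kernel eû ek)) (basis1 , settled⇒good A' step1 all)
      where
      all : ∀ j → Settled A' step1 j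
      all j with j ≟ ju
      ... | yes refl = inj₁ (coord⇒kernel A' (step1 ju) λ k → Sᵇ-false A' (step1 ju) k (first-nothing (S'ᵇ (step1 ju)) ek k))
      ... | no j≢ju  = others j j≢ju
    -- k = min S'(û): û becomes the pivot of an elimination in row k
    by-k (just k) ek = E.basis basis1 , settled⇒good A' result all
      where
      module E = PivotElimination A' step1 result ju k (Sᵇ-true A' (step1 ju) k (first-just (S'ᵇ (step1 ju)) ek))
                   (λ j → not (eqFin j ju) ∧ S'ᵇ (step1 j) k) (result-at eû ek)
                   (cong (λ b → not b ∧ S'ᵇ (step1 ju) k) (eqFin-refl ju))
                   (λ j j≢ju s → cong₂ _∧_ (cong not (eqFin-≢ j≢ju)) (∈S⇒Sᵇ A' (step1 j) k s))
      all : ∀ j → Settled A' result j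
      all j with j ≟ ju
      ... | yes refl = inj₂ (k , E.pivot-unique)
      ... | no j≢ju  = E.settled-preserved j j≢ju (others j j≢ju)

  procedure-correct : IsBasis B → Correct result
  procedure-correct basis-B = by-û uhat? refl
    where
    basis1 : IsBasis step1
    basis1 = proj₁ (step1-correct basis-B)
    all-but-û : ∀ j → uhat? ≢ just j → Settled A' step1 j
    all-but-û = proj₂ (step1-correct basis-B)
    by-û : ∀ x → uhat? ≡ x → Correct result
    by-û nothing   eû = subst Correct (sym (result-none eû))
                          (basis1 , settled⇒good A' step1 λ j → all-but-û j λ e → nothing≢just (trans (sym eû) e))
    by-û (just ju) eû = step2-correct eû basis1 λ j j≢ju → all-but-û j λ e → j≢ju (just-injective (trans (sym e) eû))

proposition2 : (p : ℕ) {{nz : NonZero p}} → Prime p →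
    {n m r : ℕ} (A A' : Zp.Mat p n m) (i : Fin n) (j : Fin m) →
    Zp.entry p A' i j ≢ Zp.entry p A i j →
    (∀ (k : Fin n) (l : Fin m) → (k ≢ i ⊎ l ≢ j) → Zp.entry p A' k l ≡ Zp.entry p A k l) →
    {_≺_ : Rel (Zp.Vect p m) 0ℓ} (ord : IsStrictTotalOrder _≡_ _≺_) →
    (B : Zp.Family p r m) → Zp.IsBasis p B → Zp.Good p A B →
    Zp.IsBasis p (Zp.Procedure.result p A A' i ord B)
    × Zp.Good p A' (Zp.Procedure.result p A A' i ord B)
proposition2 (suc q) p-prime A A' i j _ agree ord B basis-B good-B =
  ProcedureAnalysis.procedure-correct (suc q) 1<p ⁻¹-inverseˡ A A' i
    (λ k l k≢i → agree k l (inj₁ k≢i)) ord B good-B basis-B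
  where open ZpField q p-prime using (1<p; ⁻¹-inverseˡ)
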